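{- Let $t$ be a checkers term with $\Gamma\vdash^kt:L$ derivable, and suppose $(\Gamma',L')\le^-_1(\Gamma,L)$. Then there exists a derivation of $\Gamma''\vdash^{k'}t:L''$ such that one of the following holds: (i) $(\Gamma'',L'')\le^+_1(\Gamma',L')$ and $k=k'$; or (ii) $(\Gamma'',L'')=(\Gamma',L')$ and $|k'-k|=1$. Equivalently, there exists $0\le i\le1$ such that $(\Gamma'',L'')\le^+_i(\Gamma',L')$ and $|k-k'|\le 1-i$.
   Context: Checkers terms: $t ::= x\mid\lambda_cx.t\mid t\cdot^cu$, $c\in\{\circ,\bullet\}$. Types: linear $L ::= X\mid M\to_cL$; multi $M ::= [L_1,\ldots,L_n]$ (finite multisets); environments $\Gamma$ (finite support), pointwise $+$, $\Gamma,x:M$ with $x\notin\mathrm{supp}(\Gamma)$. Rules: (ax) $x:[L]\vdash^0x:L$; (many) from $\Gamma_i\vdash^{k_i}t:L_i$ ($i\in I$ finite) infer $\sum\Gamma_i\vdash^{\sum k_i}t:[L_i]_{i\in I}$; ($\lambda$) from $\Gamma,x:M\vdash^kt:L$ infer $\Gamma\vdash^k\lambda_cx.t:M\to_cL$; (@) from $\Gamma\vdash^{k_1}t:M\to_cL$ and $\Delta\vdash^{k_2}u:M$ infer $\Gamma+\Delta\vdash^kt\cdot^du:L$, $k=k_1+k_2$ if $c=d$, else $k_1+k_2+1$. Polarized whitening $\le^a_k$ ($a\in\{+,-\}$, $\bar a$ opposite), on linear and multi types by mutual induction: $X\le^a_0X$; if $M'\le^-_{k_1}M$, $L'\le^+_{k_2}L$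 then $(M'\to_\circ L')\le^+_{k_1+k_2+1}(M\to_\bullet L)$; for any $c$, if $M'\le^{\bar a}_{k_1}M$, $L'\le^a_{k_2}L$ then $(M'\to_cL')\le^a_{k_1+k_2}(M\to_cL)$; $[L'_1,\ldots,L'_n]\le^a_{\sum k_i}[L_1,\ldots,L_n]$ when $L'_i\le^a_{k_i}L_i$; no other rules. Environments pointwise with summed indices. Pairs: $(\Gamma',L')\le^a_{k_1+k_2}(\Gamma,L)$ iff $\Gamma'\le^{\bar a}_{k_1}\Gamma$ and $L'\le^a_{k_2}L$. -}

module Defs where

open import Data.Nat using (ℕ; zero; suc; _+_; _≤_; _≟_)
open import Data.List using (List; []; _∷_; _++_)
open import Data.List.Relation.Binary.Permutation.Propositional using (_↭_)
open import Data.Product using (Σ; _×_; _,_)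
open import Relation.Binary.PropositionalEquality using (_≡_)
open import Relation.Nullary using (yes; no)

data Color : Set where
  ∘c •c : Color

data Term : Set where
  var : ℕ → Term
  lam : Color → ℕ → Term → Term
  app : Term → Color → Term → Term

-- Types.  Multi types are finite multisets, represented by lists taken
-- up to permutation (all relations below are permutation-invariant).

mutual
  data Lin : Set where
    tvar : ℕ → Lin
    arr  : Multi → Color → Lin → Lin

  Multi : Set
  Multi = List Lin

-- Environments: variables ↦ multi types; empty multiset = not in support.
Env : Set
Env = ℕ → Multi

emptyEnv : Env
emptyEnv _ = []

_+ₑ_ : Env → Env → Env
(Γ +ₑ Δ) x = Γ x ++ Δ x

single : ℕ → Multi → Env
single x M y with x ≟ y
... | yes _ = M
... | no  _ = []

remove : Env → ℕ → Env
remove Γ x y with x ≟ y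
... | yes _ = []
... | no  _ = Γ y

mutual
  data _≃_ : Lin → Lin → Set where
    tvar≃ : ∀ {i} → tvar i ≃ tvar i
    arr≃  : ∀ {M M' c L L'} → M ≃ₘ M' → L ≃ L' → arr M c L ≃ arr M' c L'

  data _≃ₘ_ : Multi → Multi → Set where
    perm≃ : ∀ {M N K} → M ↭ K → PwEq K N → M ≃ₘ N

  data PwEq : Multi → Multi → Set where
    []≃ : PwEq [] []
    ∷≃  : ∀ {L L' M M'} → L ≃ L' → PwEq M M' → PwEq (L ∷ M) (L' ∷ M')

_≃ₑ_ : Env → Env → Set
Γ ≃ₑ Δ = ∀ x → Γ x ≃ₘ Δ x

cost : Color → Color → ℕ
cost ∘c ∘c = 0
cost •c •c = 0
cost ∘c •c = 1
cost •c ∘c = 1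

mutual
  data _⊢[_]_∶_ : Env → ℕ → Term → Lin → Set where
    ax   : ∀ {x L} → single x (L ∷ []) ⊢[ 0 ] var x ∶ L
    lamR : ∀ {Γ k t L c x} → Γ ⊢[ k ] t ∶ L →
           remove Γ x ⊢[ k ] lam c x t ∶ arr (Γ x) c L
    appR : ∀ {Γ Δ k₁ k₂ t u M c d L} →
           Γ ⊢[ k₁ ] t ∶ arr M c L → Δ ⊢ₘ[ k₂ ] u ∶ M →
           (Γ +ₑ Δ) ⊢[ k₁ + k₂ + cost c d ] app t d u ∶ L
    -- multisets are taken up to (deep) permutation
    conv : ∀ {Γ Γ' k t L L'} → Γ ⊢[ k ] t ∶ L → Γ ≃ₑ Γ' → L ≃ L' →
           Γ' ⊢[ k ] t ∶ L'

  -- rule (many), finite index set given as a list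
  data _⊢ₘ[_]_∶_ : Env → ℕ → Term → Multi → Set where
    many[] : ∀ {t} → emptyEnv ⊢ₘ[ 0 ] t ∶ []
    many∷  : ∀ {Γ Δ k₁ k₂ t L M} → Γ ⊢[ k₁ ] t ∶ L → Δ ⊢ₘ[ k₂ ] t ∶ M →
             (Γ +ₑ Δ) ⊢ₘ[ k₁ + k₂ ] t ∶ (L ∷ M)

data Pol : Set where
  pos neg : Pol

opp : Pol → Pol
opp pos = neg
opp neg = pos

mutual
  data LinLe : Pol → ℕ → Lin → Lin → Set where
    tvar≤ : ∀ {a i} → LinLe a 0 (tvar i) (tvar i)
    white : ∀ {k₁ k₂ M' M L' L} → MultiLe neg k₁ M' M → LinLe pos k₂ L' L →
            LinLe pos (k₁ + k₂ + 1) (arr M' ∘c L') (arr M •c L)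
    same  : ∀ {a c k₁ k₂ M' M L' L} → MultiLe (opp a) k₁ M' M → LinLe a k₂ L' L →
            LinLe a (k₁ + k₂) (arr M' c L') (arr M c L)

  -- [L'_1..L'_n] ≤ [L_1..L_n] for some enumeration of the multiset M'
  data MultiLe : Pol → ℕ → Multi → Multi → Set where
    perm≤ : ∀ {a k M' K M} → M' ↭ K → PwLe a k K M → MultiLe a k M' M

  data PwLe : Pol → ℕ → Multi → Multi → Set where
    []≤ : ∀ {a} → PwLe a 0 [] []
    ∷≤  : ∀ {a k₁ k₂ L' L M' M} → LinLe a k₁ L' L → PwLe a k₂ M' M →
          PwLe a (k₁ + k₂) (L' ∷ M') (L ∷ M)

sumTo : ℕ → (ℕ → ℕ) → ℕ
sumTo zero    f = 0
sumTo (suc n) f = sumTo n f + f n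

-- pointwise on environments, index = sum over the (finite) support
EnvLe : Pol → ℕ → Env → Env → Set
EnvLe a k Γ' Γ =
  Σ (ℕ → ℕ) λ f → Σ ℕ λ n →
    (∀ x → MultiLe a (f x) (Γ' x) (Γ x)) × (∀ x → n ≤ x → f x ≡ 0) × (k ≡ sumTo n f)

PairLe : Pol → ℕ → (Env × Lin) → (Env × Lin) → Set
PairLe a k (Γ' , L') (Γ , L) =
  Σ ℕ λ k₁ → Σ ℕ λ k₂ → (k ≡ k₁ + k₂) × EnvLe (opp a) k₁ Γ' Γ × LinLe a k₂ L' L

-- A weight-one negative whitening of (Γ, L) sits either in one entry of Γ, where it is positive, or
-- in L. Induction on the derivation pushes it towards the axioms, where x : [L] ⊢ x : L makes the
-- type and the only entry of the environment the same thing, so that a negative step on one side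
-- is a positive step on the other, at the same counter. An abstraction only moves the step between
-- the environment and the domain of the arrow. At an application t ·ᵈ u with t : M →_c L, the
-- retyped t either settles the matter, or whitens the colour c, which changes cost c d and hence
-- the counter by exactly one, or whitens M; then u must be retyped against the whiter M, which is
-- a negative step for u, and its answer may whiten M once more, a negative step for t again.
-- Every such exchange removes a black arrow from M, so it terminates.

module Submission where

open import Defs
open import Data.Nat using (ℕ; zero; suc; _+_; _≤_; _<_; _≟_; _<?_; z≤n; s≤s)
open import Data.Nat.Properties
  using (+-suc; +-comm; +-assoc; +-identityʳ; +-cancelʳ-≡; m+n≡0⇒m≡0; m+n≡0⇒n≡0; m<m+n; n<1+n;
         m<n⇒m<1+n; ≤-pred; m≤n⇒m<n∨m≡n; ≮⇒≥; <-cmp; <⇒≢; >⇒≢; +-commutativeSemigroup)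
open import Data.Nat.Induction using (<-wellFounded)
open import Induction.WellFounded using (Acc; acc)
open import Algebra.Properties.CommutativeSemigroup +-commutativeSemigroup using (interchange; x∙yz≈y∙xz)
open import Data.List using ([]; _∷_; _++_)
open import Data.List.Relation.Unary.All using (All; []; _∷_)
open import Data.List.Relation.Binary.Permutation.Propositional using (_↭_; refl; prep; swap; trans; ↭-sym)
open import Data.List.Relation.Binary.Permutation.Propositional.Properties using (All-resp-↭; ++⁺)
open import Data.Product using (Σ; _×_; _,_)
open import Data.Sum using (_⊎_; inj₁; inj₂)
open import Data.Empty using (⊥-elim)
open import Relation.Binary.Definitions using (tri<; tri≈; tri>)
open import Relation.Nullary using (¬_; yes; no)
open import Relation.Binary.PropositionalEquality
  using (_≡_; _≢_; refl; sym; cong; cong₂; subst; subst₂; ≢-sym; module ≡-Reasoning)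
  renaming (trans to ≡-trans)

variable
  a a' : Pol
  c : Color
  k k' k₁ k₂ x y : ℕ
  L L' L'' L₀ : Lin
  M M' M'' M₀ N K : Multi
  Γ Γ' Γ'' Γ₀ Δ Δ' Δ'' Δ₀ : Env

m+n≡1⇒ : ∀ m n → m + n ≡ 1 → (m ≡ 1 × n ≡ 0) ⊎ (m ≡ 0 × n ≡ 1)
m+n≡1⇒ zero          n       e = inj₂ (refl , e)
m+n≡1⇒ (suc zero)    zero    _ = inj₁ (refl , refl)
m+n≡1⇒ (suc zero)    (suc n) ()
m+n≡1⇒ (suc (suc m)) n       ()

Adjacent : ℕ → ℕ → Set
Adjacent k k' = k' ≡ suc k ⊎ k ≡ suc k'

Adjacent-+ˡ : ∀ m → Adjacent k k' → Adjacent (m + k) (m + k')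
Adjacent-+ˡ {k} m (inj₁ e) = inj₁ (≡-trans (cong (m +_) e) (+-suc m k))
Adjacent-+ˡ {k' = k'} m (inj₂ e) = inj₂ (≡-trans (cong (m +_) e) (+-suc m k'))

Adjacent-+ʳ : ∀ m → Adjacent k k' → Adjacent (k + m) (k' + m)
Adjacent-+ʳ m (inj₁ e) = inj₁ (cong (_+ m) e)
Adjacent-+ʳ m (inj₂ e) = inj₂ (cong (_+ m) e)

cost-flip : ∀ k d → Adjacent (k + cost •c d) (k + cost ∘c d)
cost-flip k ∘c = inj₂ (+-suc k 0)
cost-flip k •c = inj₁ (+-suc k 0)

VanishesFrom : ℕ → (ℕ → ℕ) → Set
VanishesFrom n f = ∀ y → n ≤ y → f y ≡ 0

sumTo-≗0 : ∀ n f → (∀ {y} → y < n → f y ≡ 0) → sumTo n f ≡ 0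
sumTo-≗0 zero    f _    = refl
sumTo-≗0 (suc n) f below = cong₂ _+_ (sumTo-≗0 n f (λ y<n → below (m<n⇒m<1+n y<n))) (below (n<1+n n))

sumTo≡0⇒ : ∀ n f → sumTo n f ≡ 0 → ∀ {y} → y < n → f y ≡ 0
sumTo≡0⇒ zero    f _ ()
sumTo≡0⇒ (suc n) f s y<1+n with m≤n⇒m<n∨m≡n (≤-pred y<1+n)
... | inj₁ y<n  = sumTo≡0⇒ n f (m+n≡0⇒m≡0 (sumTo n f) s) y<n
... | inj₂ refl = m+n≡0⇒n≡0 (sumTo n f) s

sumTo≡0⇒≗0 : ∀ n f → VanishesFrom n f → sumTo n f ≡ 0 → ∀ y → f y ≡ 0
sumTo≡0⇒≗0 n f vanish s y with y <? n
... | yes y<n = sumTo≡0⇒ n f s y<n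
... | no  y≮n = vanish y (≮⇒≥ y≮n)

sumTo≡1⇒ : ∀ n f → VanishesFrom n f → sumTo n f ≡ 1 → Σ ℕ λ x → f x ≡ 1 × (∀ y → x ≢ y → f y ≡ 0)
sumTo≡1⇒ zero    f _      ()
sumTo≡1⇒ (suc n) f vanish s with m+n≡1⇒ (sumTo n f) (f n) s
... | inj₁ (s≡1 , fn≡0) = sumTo≡1⇒ n f vanish′ s≡1
  where
  vanish′ : VanishesFrom n f
  vanish′ y n≤y with m≤n⇒m<n∨m≡n n≤y
  ... | inj₁ n<y  = vanish y n<y
  ... | inj₂ refl = fn≡0
... | inj₂ (s≡0 , fn≡1) = n , fn≡1 , others
  where
  others : ∀ y → n ≢ y → f y ≡ 0
  others y n≢y with <-cmp y n
  ... | tri< y<n _ _ = sumTo≡0⇒ n f s≡0 y<n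
  ... | tri≈ _ y≡n _ = ⊥-elim (n≢y (sym y≡n))
  ... | tri> _ _ n<y = vanish y n<y

mutual
  ≃⇒≤₀ : L ≃ L' → LinLe a 0 L L'
  ≃⇒≤₀ tvar≃        = tvar≤
  ≃⇒≤₀ (arr≃ eM eL) = same (≃ₘ⇒≤₀ eM) (≃⇒≤₀ eL)

  ≃ₘ⇒≤₀ : M ≃ₘ M' → MultiLe a 0 M M'
  ≃ₘ⇒≤₀ (perm≃ p q) = perm≤ p (PwEq⇒PwLe₀ q)

  PwEq⇒PwLe₀ : PwEq M M' → PwLe a 0 M M'
  PwEq⇒PwLe₀ []≃       = []≤
  PwEq⇒PwLe₀ (∷≃ e q) = ∷≤ (≃⇒≤₀ e) (PwEq⇒PwLe₀ q)

mutual
  ≤₀⇒≃ : LinLe a k L L' → k ≡ 0 → L ≃ L'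
  ≤₀⇒≃ tvar≤ _ = tvar≃
  ≤₀⇒≃ (white {k₁} {k₂} _ _) e with m+n≡0⇒n≡0 (k₁ + k₂) e
  ... | ()
  ≤₀⇒≃ (same {k₁ = k₁} m l) e = arr≃ (≤₀⇒≃ₘ m (m+n≡0⇒m≡0 k₁ e)) (≤₀⇒≃ l (m+n≡0⇒n≡0 k₁ e))

  ≤₀⇒≃ₘ : MultiLe a k M M' → k ≡ 0 → M ≃ₘ M'
  ≤₀⇒≃ₘ (perm≤ p q) e = perm≃ p (PwLe₀⇒PwEq q e)

  PwLe₀⇒PwEq : PwLe a k M M' → k ≡ 0 → PwEq M M'
  PwLe₀⇒PwEq []≤ _ = []≃
  PwLe₀⇒PwEq (∷≤ {k₁ = k₁} l q) e = ∷≃ (≤₀⇒≃ l (m+n≡0⇒m≡0 k₁ e)) (PwLe₀⇒PwEq q (m+n≡0⇒n≡0 k₁ e))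

PwLe-cast : k ≡ k' → PwLe a k M M' → PwLe a k' M M'
PwLe-cast {a = a} {M = M} {M'} = subst (λ k → PwLe a k M M')

PwLe-↭ : PwLe a k K M → M ↭ N → Σ Multi λ K' → K ↭ K' × PwLe a k K' N
PwLe-↭ q refl = _ , refl , q
PwLe-↭ (∷≤ l q) (prep _ p) with PwLe-↭ q p
... | _ , p' , q' = _ , prep _ p' , ∷≤ l q'
PwLe-↭ (∷≤ {k₁ = i} l (∷≤ {k₁ = j} {k₂ = k} l' q)) (swap _ _ p) with PwLe-↭ q p
... | _ , p' , q' = _ , swap _ _ p' , PwLe-cast (x∙yz≈y∙xz j i k) (∷≤ l' (∷≤ l q'))
PwLe-↭ q (trans p₁ p₂) with PwLe-↭ q p₁
... | _ , p₁' , q₁ with PwLe-↭ q₁ p₂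
...   | _ , p₂' , q₂ = _ , trans p₁' p₂' , q₂

-- Stated per type so that the nested induction through multisets, which
-- get permuted on the way, stays structural.
private
  RespectsAt : Lin → Set
  RespectsAt L = ∀ {a k L' L''} → LinLe a k L' L → L ≃ L'' → LinLe a k L' L''

  PwLe-respʳ : All RespectsAt M → PwLe a k K M → PwEq M N → PwLe a k K N
  PwLe-respʳ []       []≤      []≃       = []≤
  PwLe-respʳ (r ∷ rs) (∷≤ l q) (∷≃ e e') = ∷≤ (r l e) (PwLe-respʳ rs q e')

  MultiLe-respʳ : All RespectsAt M → MultiLe a k K M → M ≃ₘ N → MultiLe a k K N
  MultiLe-respʳ rs (perm≤ p q) (perm≃ p' e) with PwLe-↭ q p'
  ... | _ , p'' , q' = perm≤ (trans p p'') (PwLe-respʳ (All-resp-↭ p' rs) q' e)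

  mutual
    respectsAt : ∀ L → RespectsAt L
    respectsAt (tvar _)    tvar≤      tvar≃        = tvar≤
    respectsAt (arr M c L) (white m l) (arr≃ eM eL) =
      white (MultiLe-respʳ (respectsAll M) m eM) (respectsAt L l eL)
    respectsAt (arr M c L) (same m l)  (arr≃ eM eL) =
      same (MultiLe-respʳ (respectsAll M) m eM) (respectsAt L l eL)

    respectsAll : ∀ M → All RespectsAt M
    respectsAll []      = []
    respectsAll (L ∷ M) = respectsAt L ∷ respectsAll M

LinLe-respʳ-≃ : LinLe a k L' L → L ≃ L'' → LinLe a k L' L''
LinLe-respʳ-≃ {L = L} = respectsAt L

MultiLe-respʳ-≃ : MultiLe a k K M → M ≃ₘ N → MultiLe a k K N
MultiLe-respʳ-≃ {M = M} = MultiLe-respʳ (respectsAll M)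

mutual
  ≃-refl : L ≃ L
  ≃-refl {tvar _}    = tvar≃
  ≃-refl {arr M c L} = arr≃ ≃ₘ-refl ≃-refl

  ≃ₘ-refl : M ≃ₘ M
  ≃ₘ-refl = perm≃ refl PwEq-refl

  PwEq-refl : PwEq M M
  PwEq-refl {[]}    = []≃
  PwEq-refl {L ∷ M} = ∷≃ ≃-refl PwEq-refl

mutual
  ≃-sym : L ≃ L' → L' ≃ L
  ≃-sym tvar≃        = tvar≃
  ≃-sym (arr≃ eM eL) = arr≃ (≃ₘ-sym eM) (≃-sym eL)

  ≃ₘ-sym : M ≃ₘ M' → M' ≃ₘ M
  ≃ₘ-sym (perm≃ p q) with PwLe-↭ (PwEq⇒PwLe₀ {a = pos} (PwEq-sym q)) (↭-sym p)
  ... | _ , p' , q' = perm≃ p' (PwLe₀⇒PwEq q' refl)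

  PwEq-sym : PwEq M M' → PwEq M' M
  PwEq-sym []≃      = []≃
  PwEq-sym (∷≃ e q) = ∷≃ (≃-sym e) (PwEq-sym q)

≃-trans : L ≃ L' → L' ≃ L'' → L ≃ L''
≃-trans e e' = ≤₀⇒≃ (LinLe-respʳ-≃ (≃⇒≤₀ {a = pos} e) e') refl

≃ₘ-trans : M ≃ₘ M' → M' ≃ₘ M'' → M ≃ₘ M''
≃ₘ-trans e e' = ≤₀⇒≃ₘ (MultiLe-respʳ-≃ (≃ₘ⇒≤₀ {a = pos} e) e') refl

↭⇒≃ₘ : M ↭ M' → M ≃ₘ M'
↭⇒≃ₘ p = perm≃ p PwEq-refl

≃ₘ-∷ : L ≃ L' → M ≃ₘ M' → (L ∷ M) ≃ₘ (L' ∷ M')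
≃ₘ-∷ e (perm≃ p q) = perm≃ (prep _ p) (∷≃ e q)

PwLe-++ : PwLe a k₁ M M' → PwLe a k₂ N K → PwLe a (k₁ + k₂) (M ++ N) (M' ++ K)
PwLe-++ []≤ q = q
PwLe-++ {k₂ = k₂} (∷≤ {k₁ = i} {k₂ = j} l p) q = PwLe-cast (sym (+-assoc i j k₂)) (∷≤ l (PwLe-++ p q))

PwLe-++⁻ : ∀ M₁ {M₂} → PwLe a k K (M₁ ++ M₂) →
  Σ Multi λ K₁ → Σ Multi λ K₂ → Σ ℕ λ k₁ → Σ ℕ λ k₂ →
    K ≡ K₁ ++ K₂ × PwLe a k₁ K₁ M₁ × PwLe a k₂ K₂ M₂ × k ≡ k₁ + k₂
PwLe-++⁻ []       q = [] , _ , 0 , _ , refl , []≤ , q , refl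
PwLe-++⁻ (_ ∷ M₁) (∷≤ {k₁ = i} l q) with PwLe-++⁻ M₁ q
... | K₁ , K₂ , k₁ , k₂ , refl , q₁ , q₂ , refl =
  _ ∷ K₁ , K₂ , i + k₁ , k₂ , refl , ∷≤ l q₁ , q₂ , sym (+-assoc i k₁ k₂)

MultiLe-++ : MultiLe a k₁ M M' → MultiLe a k₂ N K → MultiLe a (k₁ + k₂) (M ++ N) (M' ++ K)
MultiLe-++ (perm≤ p q) (perm≤ p' q') = perm≤ (++⁺ p p') (PwLe-++ q q')

≃ₘ-++ : M ≃ₘ M' → N ≃ₘ K → (M ++ N) ≃ₘ (M' ++ K)
≃ₘ-++ e e' = ≤₀⇒≃ₘ (MultiLe-++ (≃ₘ⇒≤₀ {a = pos} e) (≃ₘ⇒≤₀ e')) refl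

≃ₑ-refl : Γ ≃ₑ Γ
≃ₑ-refl _ = ≃ₘ-refl

≃ₑ-sym : Γ ≃ₑ Γ' → Γ' ≃ₑ Γ
≃ₑ-sym e y = ≃ₘ-sym (e y)

≃ₑ-trans : Γ ≃ₑ Γ' → Γ' ≃ₑ Γ'' → Γ ≃ₑ Γ''
≃ₑ-trans e e' y = ≃ₘ-trans (e y) (e' y)

≃ₑ-+ : Γ ≃ₑ Γ' → Δ ≃ₑ Δ' → (Γ +ₑ Δ) ≃ₑ (Γ' +ₑ Δ')
≃ₑ-+ e e' y = ≃ₘ-++ (e y) (e' y)

¬MultiLe₁-[] : ¬ MultiLe a 1 M []
¬MultiLe₁-[] (perm≤ _ ())

MultiLe-singleton⁻ : MultiLe a k M (L ∷ []) → Σ Lin λ L' → M ↭ (L' ∷ []) × LinLe a k L' L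
MultiLe-singleton⁻ {L = L} (perm≤ p (∷≤ {k₁ = k} l []≤)) =
  _ , p , subst (λ k → LinLe _ k _ L) (sym (+-identityʳ k)) l

data ArrowStep : Pol → Lin → Lin → Set where
  domain   : MultiLe (opp a) 1 M' M → L' ≃ L → ArrowStep a (arr M' c L') (arr M c L)
  codomain : M' ≃ₘ M → LinLe a 1 L' L → ArrowStep a (arr M' c L') (arr M c L)
  colour   : M' ≃ₘ M → L' ≃ L → ArrowStep pos (arr M' ∘c L') (arr M •c L)

arrowStep : LinLe a k L' L → k ≡ 1 → ArrowStep a L' L
arrowStep tvar≤ ()
arrowStep (white {k₁} {k₂} m l) e =
  colour (≤₀⇒≃ₘ m (m+n≡0⇒m≡0 k₁ k₁+k₂≡0)) (≤₀⇒≃ l (m+n≡0⇒n≡0 k₁ k₁+k₂≡0))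
  where
  k₁+k₂≡0 : k₁ + k₂ ≡ 0
  k₁+k₂≡0 = +-cancelʳ-≡ 1 (k₁ + k₂) 0 e
arrowStep (same {k₁ = k₁} {k₂} m l) e with m+n≡1⇒ k₁ k₂ e
... | inj₁ (refl , refl) = domain m (≤₀⇒≃ l refl)
... | inj₂ (refl , refl) = codomain (≤₀⇒≃ₘ m refl) l

data ConsStep : Pol → Multi → Multi → Set where
  head : LinLe a 1 L' L → M' ≃ₘ M → ConsStep a (L' ∷ M') (L ∷ M)
  tail : L' ≃ L → PwLe a 1 M' M → ConsStep a (L' ∷ M') (L ∷ M)

consStep : PwLe a k M' M → k ≡ 1 → ConsStep a M' M
consStep []≤ ()
consStep (∷≤ {k₁ = k₁} {k₂} l q) e with m+n≡1⇒ k₁ k₂ e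
... | inj₁ (refl , refl) = head l (perm≃ refl (PwLe₀⇒PwEq q refl))
... | inj₂ (refl , refl) = tail (≤₀⇒≃ l refl) q

mutual
  blackL : Lin → ℕ
  blackL (tvar _)     = 0
  blackL (arr M ∘c L) = blackM M + blackL L
  blackL (arr M •c L) = suc (blackM M + blackL L)

  blackM : Multi → ℕ
  blackM []      = 0
  blackM (L ∷ M) = blackL L + blackM M

blackM-↭ : M ↭ N → blackM M ≡ blackM N
blackM-↭ refl          = refl
blackM-↭ (prep L p)    = cong (blackL L +_) (blackM-↭ p)
blackM-↭ (swap L L' p) =
  ≡-trans (x∙yz≈y∙xz (blackL L) (blackL L') _) (cong (λ n → blackL L' + (blackL L + n)) (blackM-↭ p))
blackM-↭ (trans p q)   = ≡-trans (blackM-↭ p) (blackM-↭ q)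

interchange-≡ : ∀ m' n' {m n} → m' + k₁ ≡ m → n' + k₂ ≡ n → (m' + n') + (k₁ + k₂) ≡ m + n
interchange-≡ {k₁} {k₂} m' n' e e' = ≡-trans (interchange m' n' k₁ k₂) (cong₂ _+_ e e')

mutual
  LinLe-black : LinLe a k L' L → blackL L' + k ≡ blackL L
  LinLe-black tvar≤ = refl
  LinLe-black (white {k₁} {k₂} {M'} {M} {L'} {L} m l) = begin
    blackM M' + blackL L' + (k₁ + k₂ + 1)   ≡⟨ cong (blackM M' + blackL L' +_) (+-comm (k₁ + k₂) 1) ⟩
    blackM M' + blackL L' + suc (k₁ + k₂)   ≡⟨ +-suc (blackM M' + blackL L') (k₁ + k₂) ⟩
    suc (blackM M' + blackL L' + (k₁ + k₂)) ≡⟨ cong suc (arr-black m l) ⟩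
    suc (blackM M + blackL L)               ∎
    where open ≡-Reasoning
  LinLe-black (same {c = ∘c} m l) = arr-black m l
  LinLe-black (same {c = •c} m l) = cong suc (arr-black m l)

  arr-black : MultiLe a k₁ M' M → LinLe a' k₂ L' L →
    blackM M' + blackL L' + (k₁ + k₂) ≡ blackM M + blackL L
  arr-black {M' = M'} {L' = L'} m l =
    interchange-≡ (blackM M') (blackL L') (MultiLe-black m) (LinLe-black l)

  MultiLe-black : MultiLe a k M' M → blackM M' + k ≡ blackM M
  MultiLe-black {k = k} (perm≤ p q) = ≡-trans (cong (_+ k) (blackM-↭ p)) (PwLe-black q)

  PwLe-black : PwLe a k M' M → blackM M' + k ≡ blackM M
  PwLe-black []≤      = refl
  PwLe-black (∷≤ {L' = L'} {M' = M'} l q) =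
    interchange-≡ (blackL L') (blackM M') (LinLe-black l) (PwLe-black q)

MultiLe₁-black-< : MultiLe a 1 M' M → blackM M' < blackM M
MultiLe₁-black-< {M' = M'} m = subst (blackM M' <_) (MultiLe-black m) (m<m+n (blackM M') (s≤s z≤n))

update : Env → ℕ → Multi → Env
update Γ x M y with x ≟ y
... | yes _ = M
... | no  _ = Γ y

AgreeOff : ℕ → Env → Env → Set
AgreeOff x Γ' Γ = ∀ y → x ≢ y → Γ' y ≃ₘ Γ y

≃ₑ⇒AgreeOff : Γ' ≃ₑ Γ → AgreeOff x Γ' Γ
≃ₑ⇒AgreeOff e y _ = e y

AgreeOff-refl : AgreeOff x Γ Γ
AgreeOff-refl _ _ = ≃ₘ-refl

AgreeOff-trans : AgreeOff x Γ Γ' → AgreeOff x Γ' Γ'' → AgreeOff x Γ Γ''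
AgreeOff-trans r r' y x≢y = ≃ₘ-trans (r y x≢y) (r' y x≢y)

AgreeOff⇒≃ₑ : Γ' x ≃ₘ Γ x → AgreeOff x Γ' Γ → Γ' ≃ₑ Γ
AgreeOff⇒≃ₑ {x = x} e r y with x ≟ y
... | yes refl = e
... | no  x≢y  = r y x≢y

update-≡ : ∀ Γ x → update Γ x M x ≡ M
update-≡ Γ x with x ≟ x
... | yes _   = refl
... | no  x≢x = ⊥-elim (x≢x refl)

update-≢ : ∀ Γ → x ≢ y → update Γ x M y ≡ Γ y
update-≢ {x} {y} Γ x≢y with x ≟ y
... | yes x≡y = ⊥-elim (x≢y x≡y)
... | no  _   = refl

≡⇒≃ₘ : M ≡ N → M ≃ₘ N
≡⇒≃ₘ refl = ≃ₘ-refl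

update-agree : ∀ Γ x → AgreeOff x (update Γ x M) Γ
update-agree Γ x y x≢y = ≡⇒≃ₘ (update-≢ Γ x≢y)

remove-≡ : ∀ Γ x → remove Γ x x ≡ []
remove-≡ Γ x with x ≟ x
... | yes _   = refl
... | no  x≢x = ⊥-elim (x≢x refl)

remove-≢ : ∀ Γ → x ≢ y → remove Γ x y ≡ Γ y
remove-≢ {x} {y} Γ x≢y with x ≟ y
... | yes x≡y = ⊥-elim (x≢y x≡y)
... | no  _   = refl

remove-agree : ∀ Γ x → AgreeOff x (remove Γ x) Γ
remove-agree Γ x y x≢y = ≡⇒≃ₘ (remove-≢ Γ x≢y)

remove-≃ₑ : ∀ x → AgreeOff x Γ' Γ → remove Γ' x ≃ₑ remove Γ x
remove-≃ₑ x r y with x ≟ y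
... | yes _   = ≃ₘ-refl
... | no  x≢y = r y x≢y

remove-update : Γ x ≃ₘ [] → remove (update Γ x M) x ≃ₑ Γ
remove-update {Γ} {x} e =
  AgreeOff⇒≃ₑ (subst (_≃ₘ Γ x) (sym (remove-≡ _ x)) (≃ₘ-sym e))
              (AgreeOff-trans (remove-agree _ x) (update-agree Γ x))

single-≡ : ∀ x → single x M x ≡ M
single-≡ x with x ≟ x
... | yes _   = refl
... | no  x≢x = ⊥-elim (x≢x refl)

single-agree : ∀ x → AgreeOff x (single x M) (single x N)
single-agree x y x≢y with x ≟ y
... | yes x≡y = ⊥-elim (x≢y x≡y)
... | no  _   = ≃ₘ-refl

record EnvStep (a : Pol) (Γ' Γ : Env) : Set where
  constructor envStep
  field
    at        : ℕ
    whitened  : MultiLe a 1 (Γ' at) (Γ at)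
    elsewhere : AgreeOff at Γ' Γ

EnvStep-respʳ-≃ₑ : EnvStep a Γ' Γ → Γ ≃ₑ Δ → EnvStep a Γ' Δ
EnvStep-respʳ-≃ₑ (envStep x m r) e = envStep x (MultiLe-respʳ-≃ m (e x)) (AgreeOff-trans r (≃ₑ⇒AgreeOff e))

EnvStep-+-monoˡ : EnvStep a Γ' Γ → EnvStep a (Γ' +ₑ Δ) (Γ +ₑ Δ)
EnvStep-+-monoˡ (envStep x m r) =
  envStep x (MultiLe-++ m (≃ₘ⇒≤₀ ≃ₘ-refl)) (λ y x≢y → ≃ₘ-++ (r y x≢y) ≃ₘ-refl)

EnvStep-+-monoʳ : EnvStep a Δ' Δ → EnvStep a (Γ +ₑ Δ') (Γ +ₑ Δ)
EnvStep-+-monoʳ (envStep x m r) =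
  envStep x (MultiLe-++ (≃ₘ⇒≤₀ ≃ₘ-refl) m) (λ y x≢y → ≃ₘ-++ ≃ₘ-refl (r y x≢y))

update-EnvStep : AgreeOff x Γ' Γ → MultiLe a 1 M (Γ x) → EnvStep a (update Γ' x M) Γ
update-EnvStep {x} {Γ'} {Γ} r m =
  envStep x (subst (λ M → MultiLe _ 1 M (Γ x)) (sym (update-≡ Γ' x)) m)
            (AgreeOff-trans (update-agree Γ' x) r)

update-≃ₑ : AgreeOff x Γ' Γ → M ≃ₘ Γ x → update Γ' x M ≃ₑ Γ
update-≃ₑ {x} {Γ'} {Γ} r e =
  AgreeOff⇒≃ₑ (subst (_≃ₘ Γ x) (sym (update-≡ Γ' x)) e) (AgreeOff-trans (update-agree Γ' x) r)

single-EnvStep : ∀ x → MultiLe a 1 M N → EnvStep a (single x M) (single x N)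
single-EnvStep {a} x m =
  envStep x (subst₂ (MultiLe a 1) (sym (single-≡ x)) (sym (single-≡ x)) m) (single-agree x)

EnvStep-remove : (s : EnvStep a Γ' Γ) → x ≢ EnvStep.at s → EnvStep a (remove Γ' x) (remove Γ x)
EnvStep-remove {a} {Γ'} {Γ} {x} (envStep y m r) x≢y =
  envStep y (subst₂ (MultiLe a 1) (sym (remove-≢ Γ' x≢y)) (sym (remove-≢ Γ x≢y)) m) agree
  where
  agree : AgreeOff y (remove Γ' x) (remove Γ x)
  agree z y≢z with x ≟ z
  ... | yes _ = ≃ₘ-refl
  ... | no  _ = r z y≢z

≃ₑ-update-+ˡ : ∀ Γ Δ → Γ' x ≃ₘ (M ++ Δ x) → AgreeOff x Γ' (Γ +ₑ Δ) → Γ' ≃ₑ (update Γ x M +ₑ Δ)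
≃ₑ-update-+ˡ {x = x} _ _ e r y with x ≟ y
... | yes refl = e
... | no  x≢y  = r y x≢y

≃ₑ-update-+ʳ : ∀ Γ Δ → Γ' x ≃ₘ (Γ x ++ M) → AgreeOff x Γ' (Γ +ₑ Δ) → Γ' ≃ₑ (Γ +ₑ update Δ x M)
≃ₑ-update-+ʳ {x = x} _ _ e r y with x ≟ y
... | yes refl = e
... | no  x≢y  = r y x≢y

EnvStep-+⁻ : EnvStep a Γ' (Γ +ₑ Δ) →
  (Σ Env λ Γ₀ → EnvStep a Γ₀ Γ × Γ' ≃ₑ (Γ₀ +ₑ Δ)) ⊎ (Σ Env λ Δ₀ → EnvStep a Δ₀ Δ × Γ' ≃ₑ (Γ +ₑ Δ₀))
EnvStep-+⁻ {Γ = Γ} {Δ} (envStep x (perm≤ p q) r) with PwLe-++⁻ (Γ x) q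
... | K₁ , K₂ , k₁ , k₂ , refl , q₁ , q₂ , e with m+n≡1⇒ k₁ k₂ (sym e)
...   | inj₁ (refl , refl) = inj₁ (update Γ x K₁ , update-EnvStep AgreeOff-refl (perm≤ refl q₁) ,
    ≃ₑ-update-+ˡ Γ Δ (≃ₘ-trans (↭⇒≃ₘ p) (≃ₘ-++ ≃ₘ-refl (≤₀⇒≃ₘ (perm≤ refl q₂) refl))) r)
...   | inj₂ (refl , refl) = inj₂ (update Δ x K₂ , update-EnvStep AgreeOff-refl (perm≤ refl q₂) ,
    ≃ₑ-update-+ʳ Γ Δ (≃ₘ-trans (↭⇒≃ₘ p) (≃ₘ-++ (≤₀⇒≃ₘ (perm≤ refl q₁) refl) ≃ₘ-refl)) r)

update-remove : ∀ Γ x → update (remove Γ x) x (Γ x) ≃ₑ Γ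
update-remove Γ x = update-≃ₑ (remove-agree Γ x) ≃ₘ-refl

EnvStep-update : (s : EnvStep a Γ' Γ) → x ≢ EnvStep.at s → EnvStep a (update Γ' x M) (update Γ x M)
EnvStep-update {a} {Γ'} {Γ} {x} (envStep y m r) x≢y =
  envStep y (subst₂ (MultiLe a 1) (sym (update-≢ Γ' x≢y)) (sym (update-≢ Γ x≢y)) m) agree
  where
  agree : AgreeOff y (update Γ' x _) (update Γ x _)
  agree z y≢z with x ≟ z
  ... | yes _ = ≃ₘ-refl
  ... | no  _ = r z y≢z

EnvStep-remove-≢ : (s : EnvStep a Γ' (remove Γ x)) → x ≢ EnvStep.at s
EnvStep-remove-≢ {Γ = Γ} {x} (envStep _ m _) refl = ¬MultiLe₁-[] (subst (MultiLe _ 1 _) (remove-≡ Γ x) m)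

EnvLe-0⇒≃ₑ : EnvLe a 0 Γ' Γ → Γ' ≃ₑ Γ
EnvLe-0⇒≃ₑ (f , n , le , vanish , s) y = ≤₀⇒≃ₘ (le y) (sumTo≡0⇒≗0 n f vanish (sym s) y)

≃ₑ⇒EnvLe-0 : Γ' ≃ₑ Γ → EnvLe a 0 Γ' Γ
≃ₑ⇒EnvLe-0 e = (λ _ → 0) , 0 , (λ y → ≃ₘ⇒≤₀ (e y)) , (λ _ _ → refl) , refl

EnvLe-1⇒EnvStep : EnvLe a 1 Γ' Γ → EnvStep a Γ' Γ
EnvLe-1⇒EnvStep {a} {Γ'} {Γ} (f , n , le , vanish , s) with sumTo≡1⇒ n f vanish (sym s)
... | x , fx≡1 , others =
  envStep x (subst (λ i → MultiLe a i (Γ' x) (Γ x)) fx≡1 (le x)) (λ y x≢y → ≤₀⇒≃ₘ (le y) (others y x≢y))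

EnvStep⇒EnvLe-1 : EnvStep a Γ' Γ → EnvLe a 1 Γ' Γ
EnvStep⇒EnvLe-1 {a} {Γ'} {Γ} (envStep x m r) =
  weight , suc x , le , (λ y x<y → weight-≢ y (<⇒≢ x<y)) , sym total
  where
  weight : ℕ → ℕ
  weight y with x ≟ y
  ... | yes _ = 1
  ... | no  _ = 0

  le : ∀ y → MultiLe a (weight y) (Γ' y) (Γ y)
  le y with x ≟ y
  ... | yes refl = m
  ... | no  x≢y  = ≃ₘ⇒≤₀ (r y x≢y)

  weight-≢ : ∀ y → x ≢ y → weight y ≡ 0
  weight-≢ y x≢y with x ≟ y
  ... | yes x≡y = ⊥-elim (x≢y x≡y)
  ... | no  _   = refl

  weight-≡ : weight x ≡ 1
  weight-≡ with x ≟ x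
  ... | yes _   = refl
  ... | no  x≢x = ⊥-elim (x≢x refl)

  total : sumTo (suc x) weight ≡ 1
  total = cong₂ _+_ (sumTo-≗0 x weight (λ {y} y<x → weight-≢ y (>⇒≢ y<x))) weight-≡

-- NegStep Γ' A' Γ A is (Γ', A') ≤⁻₁ (Γ, A), and Answer k k' Γ'' A'' Γ' A' is the conclusion of the
-- theorem; both use that a pair whitening of weight one lies entirely in the environment or
-- entirely in the type.
module Steps {T : Set} (_≈_ : T → T → Set) (Whitening : Pol → ℕ → T → T → Set)
             (≈-trans : ∀ {A B C} → A ≈ B → B ≈ C → A ≈ C)
             (Whitening-respʳ-≈ : ∀ {a k A B C} → Whitening a k A B → B ≈ C → Whitening a k A C) where

  private variable
    A A' A'' B : T

  data NegStep (Γ' : Env) (A' : T) (Γ : Env) (A : T) : Set where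
    env⁺  : EnvStep pos Γ' Γ → A' ≈ A → NegStep Γ' A' Γ A
    type⁻ : Γ' ≃ₑ Γ → Whitening neg 1 A' A → NegStep Γ' A' Γ A

  data Answer (k k' : ℕ) (Γ'' : Env) (A'' : T) (Γ' : Env) (A' : T) : Set where
    env⁻  : k ≡ k' → EnvStep neg Γ'' Γ' → A'' ≈ A' → Answer k k' Γ'' A'' Γ' A'
    type⁺ : k ≡ k' → Γ'' ≃ₑ Γ' → Whitening pos 1 A'' A' → Answer k k' Γ'' A'' Γ' A'
    shift : Γ'' ≃ₑ Γ' → A'' ≈ A' → Adjacent k k' → Answer k k' Γ'' A'' Γ' A'

  NegStep-respʳ : NegStep Γ' A' Γ A → Γ ≃ₑ Δ → A ≈ B → NegStep Γ' A' Δ B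
  NegStep-respʳ (env⁺ s e)  eΓ eA = env⁺ (EnvStep-respʳ-≃ₑ s eΓ) (≈-trans e eA)
  NegStep-respʳ (type⁻ e w) eΓ eA = type⁻ (≃ₑ-trans e eΓ) (Whitening-respʳ-≈ w eA)

  Answer-respʳ : Answer k k' Γ'' A'' Γ' A' → Γ' ≃ₑ Δ → A' ≈ B → Answer k k' Γ'' A'' Δ B
  Answer-respʳ (env⁻ e s eA′)   eΓ eA = env⁻ e (EnvStep-respʳ-≃ₑ s eΓ) (≈-trans eA′ eA)
  Answer-respʳ (type⁺ e eΓ′ w)  eΓ eA = type⁺ e (≃ₑ-trans eΓ′ eΓ) (Whitening-respʳ-≈ w eA)
  Answer-respʳ (shift eΓ′ eA′ j) eΓ eA = shift (≃ₑ-trans eΓ′ eΓ) (≈-trans eA′ eA) j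

open Steps _≃_ LinLe ≃-trans LinLe-respʳ-≃
open Steps _≃ₘ_ MultiLe ≃ₘ-trans MultiLe-respʳ-≃
  using ()
  renaming (NegStep to NegStepₘ; env⁺ to env⁺ₘ; type⁻ to type⁻ₘ;
            Answer to Answerₘ; env⁻ to env⁻ₘ; type⁺ to type⁺ₘ; shift to shiftₘ;
            Answer-respʳ to Answerₘ-respʳ)

data Retyped (t : Term) (k : ℕ) (Γ' : Env) (L' : Lin) : Set where
  retyped : Γ'' ⊢[ k' ] t ∶ L'' → Answer k k' Γ'' L'' Γ' L' → Retyped t k Γ' L'

data Retypedₘ (u : Term) (k : ℕ) (Δ' : Env) (M' : Multi) : Set where
  retypedₘ : Δ'' ⊢ₘ[ k' ] u ∶ M'' → Answerₘ k k' Δ'' M'' Δ' M' → Retypedₘ u k Δ' M'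

Retypes : Term → Set
Retypes t = ∀ {Γ k L Γ' L'} → Γ ⊢[ k ] t ∶ L → NegStep Γ' L' Γ L → Retyped t k Γ' L'

Retypesₘ : Term → Set
Retypesₘ u = ∀ {Δ k M Δ' M'} → Δ ⊢ₘ[ k ] u ∶ M → NegStepₘ Δ' M' Δ M → Retypedₘ u k Δ' M'

retype-var : NegStep Γ' L' (single x (L ∷ [])) L → Retyped (var x) 0 Γ' L'
retype-var {Γ'} {x = x} (env⁺ (envStep y m r) eL) with x ≟ y
... | no  _    = ⊥-elim (¬MultiLe₁-[] m)
... | yes refl with MultiLe-singleton⁻ m
...   | L₁ , p , l = retyped ax (type⁺ refl single≃Γ' (LinLe-respʳ-≃ l (≃-sym eL)))
  where
  single≃Γ' : single x (L₁ ∷ []) ≃ₑ Γ'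
  single≃Γ' = AgreeOff⇒≃ₑ (subst (_≃ₘ Γ' x) (sym (single-≡ x)) (≃ₘ-sym (↭⇒≃ₘ p)))
                          (λ z x≢z → ≃ₘ-trans (single-agree x z x≢z) (≃ₘ-sym (r z x≢z)))
retype-var {x = x} (type⁻ e l) =
  retyped ax (env⁻ refl (EnvStep-respʳ-≃ₑ (single-EnvStep x (perm≤ refl (∷≤ l []≤))) (≃ₑ-sym e)) ≃-refl)

NegStep-lam⁻ : NegStep Γ' L' (remove Γ x) (arr (Γ x) c L) →
  Σ Env λ Δ → Σ Lin λ L₀ → NegStep Δ L₀ Γ L × remove Δ x ≃ₑ Γ' × arr (Δ x) c L₀ ≃ L'
NegStep-lam⁻ {Γ' = Γ'} {L' = L'} {Γ = Γ} {x = x} {c = c} {L = L} = go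
  where
  rebind : Γ' x ≃ₘ [] → NegStep (update Γ' x M) L₀ Γ L → L' ≃ arr M c L₀ →
    Σ Env λ Δ → Σ Lin λ L₀ → NegStep Δ L₀ Γ L × remove Δ x ≃ₑ Γ' × arr (Δ x) c L₀ ≃ L'
  rebind empty s eL =
    _ , _ , s , remove-update empty , ≃-trans (arr≃ (≡⇒≃ₘ (update-≡ Γ' x)) ≃-refl) (≃-sym eL)

  empty : Γ' ≃ₑ remove Γ x → Γ' x ≃ₘ []
  empty e = subst (Γ' x ≃ₘ_) (remove-≡ Γ x) (e x)

  agree : Γ' ≃ₑ remove Γ x → AgreeOff x Γ' Γ
  agree e y x≢y = subst (Γ' y ≃ₘ_) (remove-≢ Γ x≢y) (e y)

  go : NegStep Γ' L' (remove Γ x) (arr (Γ x) c L) →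
    Σ Env λ Δ → Σ Lin λ L₀ → NegStep Δ L₀ Γ L × remove Δ x ≃ₑ Γ' × arr (Δ x) c L₀ ≃ L'
  go (env⁺ s eL) = rebind (subst (Γ' x ≃ₘ_) (remove-≡ Γ x) (EnvStep.elsewhere s x (≢-sym x≢y)))
                          (env⁺ (EnvStep-respʳ-≃ₑ (EnvStep-update s x≢y) (update-remove Γ x)) ≃-refl) eL
    where
    x≢y : x ≢ EnvStep.at s
    x≢y = EnvStep-remove-≢ s
  go (type⁻ e le) with arrowStep le refl
  ... | domain m eL₀  = rebind (empty e) (env⁺ (update-EnvStep (agree e) m) eL₀) ≃-refl
  ... | codomain eM l = rebind (empty e) (type⁻ (update-≃ₑ (agree e) eM) l) ≃-refl

Answer-lam : Answer k k' Γ'' L'' Δ L₀ →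
  Answer k k' (remove Γ'' x) (arr (Γ'' x) c L'') (remove Δ x) (arr (Δ x) c L₀)
Answer-lam {x = x} (env⁻ e (envStep y m r) eL) with x ≟ y
... | yes refl = type⁺ e (remove-≃ₑ x r) (same m (≃⇒≤₀ eL))
... | no  x≢y  = env⁻ e (EnvStep-remove (envStep y m r) x≢y) (arr≃ (r x (≢-sym x≢y)) eL)
Answer-lam {x = x} (type⁺ e eΓ l)   = type⁺ e (remove-≃ₑ x (≃ₑ⇒AgreeOff eΓ)) (same (≃ₘ⇒≤₀ (eΓ x)) l)
Answer-lam {x = x} (shift eΓ eL j)  = shift (remove-≃ₑ x (≃ₑ⇒AgreeOff eΓ)) (arr≃ (eΓ x) eL) j

NegStepₘ-∷⁻ : NegStepₘ Δ' M' (Γ +ₑ Δ) (L ∷ M) →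
  (Σ Env λ Γ₀ → Σ Lin λ L₀ → NegStep Γ₀ L₀ Γ L × Δ' ≃ₑ (Γ₀ +ₑ Δ) × M' ≃ₘ (L₀ ∷ M)) ⊎
  (Σ Env λ Δ₀ → Σ Multi λ M₀ → NegStepₘ Δ₀ M₀ Δ M × Δ' ≃ₑ (Γ +ₑ Δ₀) × M' ≃ₘ (L ∷ M₀))
NegStepₘ-∷⁻ (env⁺ₘ s eM) with EnvStep-+⁻ s
... | inj₁ (_ , s₀ , eΔ) = inj₁ (_ , _ , env⁺ s₀ ≃-refl , eΔ , eM)
... | inj₂ (_ , s₀ , eΔ) = inj₂ (_ , _ , env⁺ₘ s₀ ≃ₘ-refl , eΔ , eM)
NegStepₘ-∷⁻ (type⁻ₘ eΔ (perm≤ p q)) with consStep q refl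
... | head l eM = inj₁ (_ , _ , type⁻ ≃ₑ-refl l , eΔ , ≃ₘ-trans (↭⇒≃ₘ p) (≃ₘ-∷ ≃-refl eM))
... | tail eL q' = inj₂ (_ , _ , type⁻ₘ ≃ₑ-refl (perm≤ refl q') , eΔ , ≃ₘ-trans (↭⇒≃ₘ p) (≃ₘ-∷ eL ≃ₘ-refl))

Answer-∷-head : ∀ i → Answer k k' Γ'' L'' Γ₀ L₀ →
  Answerₘ (k + i) (k' + i) (Γ'' +ₑ Δ) (L'' ∷ M) (Γ₀ +ₑ Δ) (L₀ ∷ M)
Answer-∷-head i (env⁻ e s eL)   = env⁻ₘ (cong (_+ i) e) (EnvStep-+-monoˡ s) (≃ₘ-∷ eL ≃ₘ-refl)
Answer-∷-head i (type⁺ e eΓ l)  =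
  type⁺ₘ (cong (_+ i) e) (≃ₑ-+ eΓ ≃ₑ-refl) (perm≤ refl (∷≤ l (PwEq⇒PwLe₀ PwEq-refl)))
Answer-∷-head i (shift eΓ eL j) = shiftₘ (≃ₑ-+ eΓ ≃ₑ-refl) (≃ₘ-∷ eL ≃ₘ-refl) (Adjacent-+ʳ i j)

Answer-∷-tail : ∀ i → Answerₘ k k' Δ'' M'' Δ₀ M₀ →
  Answerₘ (i + k) (i + k') (Γ +ₑ Δ'') (L ∷ M'') (Γ +ₑ Δ₀) (L ∷ M₀)
Answer-∷-tail i (env⁻ₘ e s eM)   = env⁻ₘ (cong (i +_) e) (EnvStep-+-monoʳ s) (≃ₘ-∷ ≃-refl eM)
Answer-∷-tail i (type⁺ₘ e eΔ (perm≤ p q)) =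
  type⁺ₘ (cong (i +_) e) (≃ₑ-+ ≃ₑ-refl eΔ) (perm≤ (prep _ p) (∷≤ (≃⇒≤₀ ≃-refl) q))
Answer-∷-tail i (shiftₘ eΔ eM j) = shiftₘ (≃ₑ-+ ≃ₑ-refl eΔ) (≃ₘ-∷ ≃-refl eM) (Adjacent-+ˡ i j)

module Application (t : Term) (d : Color) (u : Term) (retype-t : Retypes t) (retype-u : Retypesₘ u) where

  mutual
    fromFunction : ∀ {kt ku} → Acc _<_ (blackM M) → Retyped t kt Γ₀ (arr M c L₀) → Δ ⊢ₘ[ ku ] u ∶ M →
      Γ' ≃ₑ (Γ₀ +ₑ Δ) → L₀ ≃ L' → Retyped (app t d u) (kt + ku + cost c d) Γ' L'
    fromFunction _ (retyped dt (env⁻ refl s eT)) du eΓ eL =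
      retyped (appR (conv dt ≃ₑ-refl eT) du)
        (env⁻ refl (EnvStep-respʳ-≃ₑ (EnvStep-+-monoˡ s) (≃ₑ-sym eΓ)) eL)
    fromFunction {kt = kt} {ku} (acc rs) (retyped dt (type⁺ refl eΓ₀ le)) du eΓ eL with arrowStep le refl
    ... | colour eM eL₀ = retyped (appR (conv dt ≃ₑ-refl (arr≃ eM ≃-refl)) du)
      (shift (≃ₑ-trans (≃ₑ-+ eΓ₀ ≃ₑ-refl) (≃ₑ-sym eΓ)) (≃-trans eL₀ eL) (cost-flip (kt + ku) d))
    ... | codomain eM l = retyped (appR (conv dt ≃ₑ-refl (arr≃ eM ≃-refl)) du)
      (type⁺ refl (≃ₑ-trans (≃ₑ-+ eΓ₀ ≃ₑ-refl) (≃ₑ-sym eΓ)) (LinLe-respʳ-≃ l eL))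
    ... | domain m eL₀ = fromArgument (rs (MultiLe₁-black-< m)) (retype-u du (type⁻ₘ ≃ₑ-refl m)) dt
      (≃ₑ-trans eΓ (≃ₑ-+ (≃ₑ-sym eΓ₀) ≃ₑ-refl)) (≃-trans eL₀ eL)
    fromFunction _ (retyped dt (shift eΓ₀ eT j)) du eΓ eL =
      retyped (appR (conv dt ≃ₑ-refl eT) du)
        (shift (≃ₑ-trans (≃ₑ-+ eΓ₀ ≃ₑ-refl) (≃ₑ-sym eΓ)) eL (Adjacent-+ʳ _ (Adjacent-+ʳ _ j)))

    fromArgument : ∀ {kt ku} → Acc _<_ (blackM M) → Retypedₘ u ku Δ₀ M → Γ ⊢[ kt ] t ∶ arr M c L₀ →
      Γ' ≃ₑ (Γ +ₑ Δ₀) → L₀ ≃ L' → Retyped (app t d u) (kt + ku + cost c d) Γ' L'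
    fromArgument _ (retypedₘ du (env⁻ₘ refl s eM)) dt eΓ eL =
      retyped (appR (conv dt ≃ₑ-refl (arr≃ (≃ₘ-sym eM) ≃-refl)) du)
        (env⁻ refl (EnvStep-respʳ-≃ₑ (EnvStep-+-monoʳ s) (≃ₑ-sym eΓ)) eL)
    fromArgument (acc rs) (retypedₘ du (type⁺ₘ refl eΔ₀ m)) dt eΓ eL =
      fromFunction (rs (MultiLe₁-black-< m)) (retype-t dt (type⁻ ≃ₑ-refl (same m (≃⇒≤₀ ≃-refl)))) du
        (≃ₑ-trans eΓ (≃ₑ-+ ≃ₑ-refl (≃ₑ-sym eΔ₀))) eL
    fromArgument {c = c} {kt = kt} _ (retypedₘ du (shiftₘ eΔ₀ eM j)) dt eΓ eL =
      retyped (appR (conv dt ≃ₑ-refl (arr≃ (≃ₘ-sym eM) ≃-refl)) du)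
        (shift (≃ₑ-trans (≃ₑ-+ ≃ₑ-refl eΔ₀) (≃ₑ-sym eΓ)) eL (Adjacent-+ʳ (cost c d) (Adjacent-+ˡ kt j)))

  retype-app : Γ ⊢[ k₁ ] t ∶ arr M c L → Δ ⊢ₘ[ k₂ ] u ∶ M → NegStep Γ' L' (Γ +ₑ Δ) L →
    Retyped (app t d u) (k₁ + k₂ + cost c d) Γ' L'
  retype-app dt du (env⁺ s eL) with EnvStep-+⁻ s
  ... | inj₁ (_ , s₀ , eΓ) =
    fromFunction (<-wellFounded _) (retype-t dt (env⁺ s₀ ≃-refl)) du eΓ (≃-sym eL)
  ... | inj₂ (_ , s₀ , eΓ) =
    fromArgument (<-wellFounded _) (retype-u du (env⁺ₘ s₀ ≃ₘ-refl)) dt eΓ (≃-sym eL)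
  retype-app dt du (type⁻ eΓ l) =
    fromFunction (<-wellFounded _) (retype-t dt (type⁻ ≃ₑ-refl (same (≃ₘ⇒≤₀ ≃ₘ-refl) l))) du eΓ ≃-refl

mutual
  retype : ∀ t → Retypes t
  retype t           (conv d eΓ eL) s = retype t d (NegStep-respʳ s (≃ₑ-sym eΓ) (≃-sym eL))
  retype (var x)     ax             s = retype-var s
  retype (lam c x t) (lamR d)       s with NegStep-lam⁻ s
  ... | _ , _ , s' , eΓ , eL with retype t d s'
  ...   | retyped d' ans = retyped (lamR d') (Answer-respʳ (Answer-lam ans) eΓ eL)
  retype (app t d u) (appR dt du)   s = Application.retype-app t d u (retype t) (retypeₘ u) dt du s

  retypeₘ : ∀ u → Retypesₘ u
  retypeₘ u many[] (env⁺ₘ (envStep _ m _) _) = ⊥-elim (¬MultiLe₁-[] m)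
  retypeₘ u many[] (type⁻ₘ _ m)              = ⊥-elim (¬MultiLe₁-[] m)
  retypeₘ u (many∷ {k₂ = k₂} d ds) s with NegStepₘ-∷⁻ s
  ... | inj₁ (_ , _ , s' , eΔ , eM) with retype u d s'
  ...   | retyped d' ans =
    retypedₘ (many∷ d' ds) (Answerₘ-respʳ (Answer-∷-head k₂ ans) (≃ₑ-sym eΔ) (≃ₘ-sym eM))
  retypeₘ u (many∷ {k₁ = k₁} d ds) s | inj₂ (_ , _ , s' , eΔ , eM) with retypeₘ u ds s'
  ...   | retypedₘ ds' ans =
    retypedₘ (many∷ d ds') (Answerₘ-respʳ (Answer-∷-tail k₁ ans) (≃ₑ-sym eΔ) (≃ₘ-sym eM))

PairLe⇒NegStep : PairLe neg 1 (Γ' , L') (Γ , L) → NegStep Γ' L' Γ L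
PairLe⇒NegStep (k₁ , k₂ , e , le , l) with m+n≡1⇒ k₁ k₂ (sym e)
... | inj₁ (refl , refl) = env⁺ (EnvLe-1⇒EnvStep le) (≤₀⇒≃ l refl)
... | inj₂ (refl , refl) = type⁻ (EnvLe-0⇒≃ₑ le) l

Answer⇒PairLe : Answer k k' Γ'' L'' Γ' L' →
  (PairLe pos 1 (Γ'' , L'') (Γ' , L') × k ≡ k') ⊎ ((Γ'' ≃ₑ Γ') × (L'' ≃ L') × Adjacent k k')
Answer⇒PairLe (env⁻ e s eL)   = inj₁ ((1 , 0 , refl , EnvStep⇒EnvLe-1 s , ≃⇒≤₀ eL) , e)
Answer⇒PairLe (type⁺ e eΓ l)  = inj₁ ((0 , 1 , refl , ≃ₑ⇒EnvLe-0 eΓ , l) , e)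
Answer⇒PairLe (shift eΓ eL j) = inj₂ (eΓ , eL , j)

lemma6 : ∀ {t Γ k L Γ' L'} → Γ ⊢[ k ] t ∶ L → PairLe neg 1 (Γ' , L') (Γ , L) →
    Σ Env λ Γ'' → Σ Lin λ L'' → Σ ℕ λ k' → (Γ'' ⊢[ k' ] t ∶ L'') ×
      ((PairLe pos 1 (Γ'' , L'') (Γ' , L') × k ≡ k')
       ⊎ ((Γ'' ≃ₑ Γ') × (L'' ≃ L') × (k' ≡ suc k ⊎ k ≡ suc k')))
lemma6 {t} d w with retype t d (PairLe⇒NegStep w)
... | retyped d' ans = _ , _ , _ , d' , Answer⇒PairLe ans
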